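{- If a span of monomorphisms $G \xleftarrow{g} I \xrightarrow{h} H$ in $\mathbf{BGraph}_T$ is boundary-$!$-coherent, then it has a pushout in $\mathbf{BGraph}_T$.
   Context: Fix a compressed monoidal signature $T=(O,M,\mathrm{dom},\mathrm{cod})$, $\mathrm{dom},\mathrm{cod}: M \rightarrow (O\times\{\mathsf{v},\mathsf{f}\})^*$. The derived compressed typegraph $\mathcal{G}_T$ has vertex set $O\sqcup M$, a self-loop on each $X\in O$, an edge $\mathrm{in}^a_{f,i}$ from $X$ to $f$ for each $f\in M$ and index $i$ with $\mathrm{dom}(f)[i]=(X,a)$, and an edge $\mathrm{out}^a_{f,j}$ from $f$ to $X$ for each index $j$ with $\mathrm{cod}(f)[j]=(X,a)$. $\mathcal{G}_{T!}$ is $\mathcal{G}_T$ plus a vertex $!$, a self-loop on $!$, and an edge from $!$ to each vertex of $\mathcal{G}_T$. For a finite directed multigraph $G$ typed over $\mathcal{G}_{T!}$, vertices typed in $O$, $M$, $!$ are wire-, node-, $!$-vertices; fixed-arity edges are those typed by an $\mathsf{f}$-tagged edge; $U(G)$ deletes $!$-vertices and incident edges (and $U$ acts on morphisms by restriction). A string graph is a $\mathcal{G}_T$-typed graph whose typing restricts at each node-vertex to a bijection on incident fixed-arity edges and whose wire-vertices have at most one incoming and one outgoing edge. An open subgraph $O'$ of a string graph $K$ is a string subgraph with no vertex adjacent to a wire-vertex outside $O'$ and no incident fixed-arity edge outside $O'$. $B(b)$ is the full subgraph on successors of a $!$-vertex $b$, $\beta(G)$ the full subgraph on $!$-vertices.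 A $!$-graph is a $\mathcal{G}_{T!}$-typed graph with $U(G)$ a string graph, $\beta(G)$ posetal (at most one edge between two vertices, edge relation a partial order), $U(B(b))$ open in $U(G)$ for each $!$-vertex $b$, and $B(b')\subseteq B(b)$ whenever $b'\in B(b)$; $\mathbf{BGraph}_T$ is the full subcategory of $\mathbf{Graph}/\mathcal{G}_{T!}$ on $!$-graphs. An input (output) of a string graph is a wire-vertex with no incoming (outgoing) edge. A span $A \xleftarrow{a} C \xrightarrow{c} B$ of string graph morphisms is boundary-coherent if for every input $v$ of $C$ at least one of $a(v), c(v)$ is an input, and for every output $v$ of $C$ at least one of $a(v),c(v)$ is an output. A $!$-graph morphism $f : X \rightarrow Y$ reflects $!$-box containment if every edge of $Y$ whose source is a $!$-vertex and whose target is in the image of $f$ is itself in the image of $f$. A span of monomorphisms $G \xleftarrow{g} I \xrightarrow{h} H$ of $!$-graphs is boundary-$!$-coherent if the span $U(G)\xleftarrow{U(g)} U(I) \xrightarrow{U(h)} U(H)$ is boundary-coherent and both $g$ and $h$ reflect $!$-box containment. -}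

module Defs where

open import Data.Nat using (ℕ)
open import Data.Fin using (Fin)
open import Data.List using (List; length; lookup)
open import Data.Product using (Σ; _×_; _,_; proj₁; proj₂)
open import Data.Sum using (_⊎_)
open import Data.Bool using (Bool; true; false)
open import Data.Unit using (⊤)
open import Data.Empty using (⊥)
open import Function.Bundles using (_↔_)
open import Relation.Binary.PropositionalEquality using (_≡_; trans; cong)

data Tag : Set where
  v-tag f-tag : Tag

record Sig : Set₁ where
  field
    O   : Set
    M   : Set
    dom : M → List (O × Tag)
    cod : M → List (O × Tag)

Finite : Set → Set
Finite A = Σ ℕ λ n → A ↔ Fin n

module _ (T : Sig) where
  open Sig T

  -- The typegraph G_{T!} (which contains G_T as the part not touching !)

  data TV : Set where
    ob   : O → TV
    mo   : M → TV
    bang : TV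

  data TE : Set where
    loopO : O → TE
    inE   : (f : M) → Fin (length (dom f)) → TE
    outE  : (f : M) → Fin (length (cod f)) → TE
    loopB : TE
    bangO : O → TE
    bangM : M → TE

  tsrc : TE → TV
  tsrc (loopO X)  = ob X
  tsrc (inE f i)  = ob (proj₁ (lookup (dom f) i))
  tsrc (outE f j) = mo f
  tsrc loopB      = bang
  tsrc (bangO X)  = bang
  tsrc (bangM f)  = bang

  ttgt : TE → TV
  ttgt (loopO X)  = ob X
  ttgt (inE f i)  = mo f
  ttgt (outE f j) = ob (proj₁ (lookup (cod f) j))
  ttgt loopB      = bang
  ttgt (bangO X)  = ob X
  ttgt (bangM f)  = mo f

  -- fixed-arity edges of the typegraph: those tagged f
  IsFixedT : TE → Set
  IsFixedT (inE f i)  = proj₂ (lookup (dom f) i) ≡ f-tag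
  IsFixedT (outE f j) = proj₂ (lookup (cod f) j) ≡ f-tag
  IsFixedT _          = ⊥

  IsWireT : TV → Set
  IsWireT (ob _) = ⊤
  IsWireT _      = ⊥

  IsBangT : TV → Set
  IsBangT bang = ⊤
  IsBangT _    = ⊥

  isBang : TV → Bool
  isBang bang = true
  isBang _    = false

  -- Directed multigraphs typed over G_{T!} (objects of Graph/G_{T!})

  record TGraph : Set₁ where
    field
      V      : Set
      E      : Set
      src    : E → V
      tgt    : E → V
      tyV    : V → TV
      tyE    : E → TE
      src-ty : ∀ e → tsrc (tyE e) ≡ tyV (src e)
      tgt-ty : ∀ e → ttgt (tyE e) ≡ tyV (tgt e)

  open TGraph public

  record Hom (X Y : TGraph) : Set where
    field
      fV     : V X → V Y
      fE     : E X → E Y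
      src-pr : ∀ e → src Y (fE e) ≡ fV (src X e)
      tgt-pr : ∀ e → tgt Y (fE e) ≡ fV (tgt X e)
      tyV-pr : ∀ v → tyV Y (fV v) ≡ tyV X v
      tyE-pr : ∀ e → tyE Y (fE e) ≡ tyE X e

  open Hom public

  _∘H_ : {X Y Z : TGraph} → Hom Y Z → Hom X Y → Hom X Z
  _∘H_ {X} {Y} {Z} g f = record
    { fV = λ v → fV g (fV f v)
    ; fE = λ e → fE g (fE f e)
    ; src-pr = λ e → trans (src-pr g (fE f e)) (cong (fV g) (src-pr f e))
    ; tgt-pr = λ e → trans (tgt-pr g (fE f e)) (cong (fV g) (tgt-pr f e))
    ; tyV-pr = λ v → trans (tyV-pr g (fV f v)) (tyV-pr f v)
    ; tyE-pr = λ e → trans (tyE-pr g (fE f e)) (tyE-pr f e)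
    }

  _≈H_ : {X Y : TGraph} → Hom X Y → Hom X Y → Set
  f ≈H f' = (∀ v → fV f v ≡ fV f' v) × (∀ e → fE f e ≡ fE f' e)

  Mono : {X Y : TGraph} → Hom X Y → Set
  Mono f = (∀ v w → fV f v ≡ fV f w → v ≡ w) × (∀ e d → fE f e ≡ fE f d → e ≡ d)

  module _ (G : TGraph) where

    IsWire : V G → Set
    IsWire v = IsWireT (tyV G v)

    IsNode : V G → M → Set
    IsNode v f = tyV G v ≡ mo f

    IsBangV : V G → Set
    IsBangV v = IsBangT (tyV G v)

    IsFixed : E G → Set
    IsFixed e = IsFixedT (tyE G e)

    -- U(G): vertices / edges that survive deletion of !-vertices
    UV : V G → Set
    UV v = isBang (tyV G v) ≡ false

    UE : E G → Set
    UE e = UV (src G e) × UV (tgt G e)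

    Inc : V G → E G → Set
    Inc v e = (src G e ≡ v) ⊎ (tgt G e ≡ v)

    -- The subgraph of G given by the vertex predicate SV and edge
    -- predicate SE (typed over G_T, i.e. inside U(G)) is a string graph.
    IsStringOn : (V G → Set) → (E G → Set) → Set
    IsStringOn SV SE =
        (∀ e → SE e → SV (src G e) × SV (tgt G e))
        -- typing at each node-vertex is a bijection on incident fixed-arity edges
      × (∀ n f → SV n → IsNode n f →
            (∀ e d → SE e → SE d → Inc n e → Inc n d → IsFixed e → IsFixed d →
                tyE G e ≡ tyE G d → e ≡ d)
          × (∀ t → IsFixedT t → (tsrc t ≡ mo f) ⊎ (ttgt t ≡ mo f) →
                Σ (E G) λ e → SE e × Inc n e × tyE G e ≡ t))
      × (∀ w → SV w → IsWire w → ∀ e d → SE e → SE d →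
            tgt G e ≡ w → tgt G d ≡ w → e ≡ d)
      × (∀ w → SV w → IsWire w → ∀ e d → SE e → SE d →
            src G e ≡ w → src G d ≡ w → e ≡ d)

    UIsString : Set
    UIsString = IsStringOn UV UE

    -- the subgraph (SV,SE) is an open subgraph of the string graph (AV,AE)
    IsOpenIn : (AV : V G → Set) (AE : E G → Set)
               (SV : V G → Set) (SE : E G → Set) → Set
    IsOpenIn AV AE SV SE =
        (∀ v → SV v → AV v) × (∀ e → SE e → AE e)
      × IsStringOn SV SE
      × (∀ e → AE e → SV (src G e) → IsWire (tgt G e) → SV (tgt G e))
      × (∀ e → AE e → SV (tgt G e) → IsWire (src G e) → SV (src G e))
      × (∀ e → AE e → IsFixed e → SV (src G e) ⊎ SV (tgt G e) → SE e)

    Succ : V G → V G → Set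
    Succ b v = Σ (E G) λ e → (src G e ≡ b) × (tgt G e ≡ v)

    -- U(B(b)) : B(b) is the full subgraph on the successors of b
    UBV : V G → V G → Set
    UBV b v = UV v × Succ b v

    UBE : V G → E G → Set
    UBE b e = UE e × Succ b (src G e) × Succ b (tgt G e)

    BetaPosetal : Set
    BetaPosetal =
        (∀ e d → IsBangV (src G e) → IsBangV (tgt G e) →
            src G e ≡ src G d → tgt G e ≡ tgt G d → e ≡ d)
      × (∀ b → IsBangV b → Succ b b)
      × (∀ b b' b'' → IsBangV b → IsBangV b' → IsBangV b'' →
            Succ b b' → Succ b' b'' → Succ b b'')
      × (∀ b b' → IsBangV b → IsBangV b' → Succ b b' → Succ b' b → b ≡ b')

    -- G is a !-graph (an object of BGraph_T); finiteness included
    IsBGraph : Set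
    IsBGraph =
        Finite (V G) × Finite (E G)
      × UIsString
      × BetaPosetal
      × (∀ b → IsBangV b → IsOpenIn UV UE (UBV b) (UBE b))
      × (∀ b b' → IsBangV b → IsBangV b' → Succ b b' →
            ∀ v → Succ b' v → Succ b v)

    IsInput : V G → Set
    IsInput v = UV v × IsWire v × (∀ e → UE e → tgt G e ≡ v → ⊥)

    IsOutput : V G → Set
    IsOutput v = UV v × IsWire v × (∀ e → UE e → src G e ≡ v → ⊥)

  -- U(A) <- U(C) -> U(B) boundary-coherent (U acts by restriction)
  BoundaryCoherent : {A B C : TGraph} → Hom C A → Hom C B → Set
  BoundaryCoherent {A} {B} {C} a c =
      (∀ v → IsInput C v → IsInput A (fV a v) ⊎ IsInput B (fV c v))
    × (∀ v → IsOutput C v → IsOutput A (fV a v) ⊎ IsOutput B (fV c v))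

  ReflectsBangBox : {X Y : TGraph} → Hom X Y → Set
  ReflectsBangBox {X} {Y} f =
    ∀ e → IsBangV Y (src Y e) → ∀ x → tgt Y e ≡ fV f x →
      Σ (E X) λ e' → fE f e' ≡ e

  BoundaryBangCoherent : {G H I : TGraph} → Hom I G → Hom I H → Set
  BoundaryBangCoherent g h =
    BoundaryCoherent g h × ReflectsBangBox g × ReflectsBangBox h

  -- Pushouts in BGraph_T (a full subcategory of Graph/G_{T!})

  IsPushout : {G H I P : TGraph} (g : Hom I G) (h : Hom I H)
              (p₁ : Hom G P) (p₂ : Hom H P) → Set₁
  IsPushout {G} {H} {I} {P} g h p₁ p₂ =
      ((p₁ ∘H g) ≈H (p₂ ∘H h))
    × (∀ (Q : TGraph) → IsBGraph Q → (q₁ : Hom G Q) (q₂ : Hom H Q) →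
         (q₁ ∘H g) ≈H (q₂ ∘H h) →
         Σ (Hom P Q) λ u → ((u ∘H p₁) ≈H q₁) × ((u ∘H p₂) ≈H q₂)
           × (∀ (u' : Hom P Q) → (u' ∘H p₁) ≈H q₁ → (u' ∘H p₂) ≈H q₂ → u' ≈H u))

  HasPushoutInBGraph : {G H I : TGraph} (g : Hom I G) (h : Hom I H) → Set₁
  HasPushoutInBGraph {G} {H} {I} g h =
    Σ TGraph λ P → IsBGraph P × Σ (Hom G P) λ p₁ → Σ (Hom H P) λ p₂ → IsPushout g h p₁ p₂

-- The pushout is first computed in Graph/G_{T!}. Since h is a monomorphism with decidable
-- image (I and H are finite), it is G together with the vertices and edges of H outside
-- the image of h, fresh edges keeping their pushed-forward endpoints (InjectivePushout,
-- GraphPushout). Its universal property holds against all typed graphs, so it is a pushout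
-- in the full subcategory BGraph_T as soon as it is a !-graph (PushoutOfBGraphs):
--   * as g and h reflect !-box containment, every !-box edge of the pushout is the image of
--     a !-box edge of G or of H (box-into-G, box-into-H); posetality of β, nesting of boxes
--     and openness of boxes (recast as closure along edge classes, BoxClosure) are then
--     inherited from G and H;
--   * since I is a string graph, no fresh fixed-arity edge of H meets a glued node, and by
--     boundary coherence no glued wire gets incoming (outgoing) edges from both G and H,
--     so U of the pushout is a string graph.

module Submission where

open import Defs
open import Data.Nat using (zero; suc; _+_)
open import Data.Fin using (Fin; zero; suc)
open import Data.Fin.Properties using (any?; +↔⊎; inj⇒≟)
open import Data.Product using (Σ; ∃; _×_; _,_; proj₁; proj₂)
open import Data.Sum using (_⊎_; inj₁; inj₂) renaming ([_,_] to either)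
import Data.Sum as Sum
open import Data.Sum.Properties using (inj₁-injective; inj₂-injective)
open import Data.Sum.Function.Propositional using (_⊎-↔_)
open import Data.Bool using (false)
open import Data.Empty using (⊥; ⊥-elim; ⊥-elim-irr)
open import Data.Irrelevant using (Irrelevant; [_])
import Data.Irrelevant as Irrelevant
open import Data.Refinement using (Refinement-syntax; _,_; value; value-injective)
open import Function.Base using (_∘_)
open import Function.Bundles using (_↔_; Inverse; mk↔ₛ′)
open import Function.Properties.Inverse using (↔-sym; ↔-trans; ↔⇒↣)
open import Relation.Nullary using (¬_; Dec; yes; no; map′; ¬?)
open import Relation.Binary.PropositionalEquality
  using (_≡_; refl; sym; trans; cong; subst; module ≡-Reasoning)

finite-≟ : {A : Set} → Finite A → (x y : A) → Dec (x ≡ y)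
finite-≟ (_ , φ) = inj⇒≟ (↔⇒↣ φ)

finite-any? : {A : Set} {P : A → Set} → Finite A → (∀ a → Dec (P a)) → Dec (∃ P)
finite-any? {P = P} (_ , φ) P? =
  map′ (λ (i , p) → from i , p)
       (λ (a , p) → to a , subst P (sym (strictlyInverseʳ a)) p)
       (any? (P? ∘ from))
  where open Inverse φ

finite-⊎ : {A B : Set} → Finite A → Finite B → Finite (A ⊎ B)
finite-⊎ (m , φ) (n , ψ) = m + n , ↔-trans (φ ⊎-↔ ψ) (↔-sym +↔⊎)

suc-refinement : ∀ {n} {P : Fin (suc n) → Set} → [ i ∈ Fin n ∣ P (suc i) ] → [ i ∈ Fin (suc n) ∣ P i ]
suc-refinement (i , q) = suc i , q

fin-refinement : ∀ n {P : Fin n → Set} → (∀ i → Dec (P i)) → Finite [ i ∈ Fin n ∣ P i ]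
fin-refinement zero P? = 0 , mk↔ₛ′ (λ { (() , _) }) (λ ()) (λ ()) (λ { (() , _) })
fin-refinement (suc n) {P} P? with fin-refinement n (P? ∘ suc) | P? zero
... | k , φ | yes p = suc k , mk↔ₛ′ to′ from′
        (λ { zero → refl ; (suc j) → cong suc (strictlyInverseˡ j) })
        (λ { (zero , _) → refl ; (suc i , q) → cong suc-refinement (strictlyInverseʳ (i , q)) })
  where
  open Inverse φ
  to′ : [ i ∈ Fin (suc n) ∣ P i ] → Fin (suc k)
  to′ (zero , _) = zero
  to′ (suc i , q) = suc (to (i , q))
  from′ : Fin (suc k) → [ i ∈ Fin (suc n) ∣ P i ]
  from′ zero = zero , [ p ]
  from′ (suc j) = suc-refinement (from j)
... | k , φ | no ¬p = k , mk↔ₛ′ to′ (suc-refinement ∘ from) strictlyInverseˡ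
        (λ { (zero , [ p ]) → ⊥-elim-irr (¬p p) ; (suc i , q) → cong suc-refinement (strictlyInverseʳ (i , q)) })
  where
  open Inverse φ
  to′ : [ i ∈ Fin (suc n) ∣ P i ] → Fin k
  to′ (zero , [ p ]) = ⊥-elim-irr (¬p p)
  to′ (suc i , q) = to (i , q)

finite-refinement : {A : Set} {P : A → Set} → Finite A → (∀ a → Dec (P a)) → Finite [ a ∈ A ∣ P a ]
finite-refinement {A} {P} (n , φ) P? = proj₁ counted , ↔-trans reindex (proj₂ counted)
  where
  open Inverse φ
  counted : Finite [ i ∈ Fin n ∣ P (from i) ]
  counted = fin-refinement n (P? ∘ from)
  reindex : [ a ∈ A ∣ P a ] ↔ [ i ∈ Fin n ∣ P (from i) ]
  reindex = mk↔ₛ′ (λ (a , q) → to a , Irrelevant.map (subst P (sym (strictlyInverseʳ a))) q)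
                  (λ (i , q) → from i , q)
                  (λ _ → value-injective (strictlyInverseˡ _))
                  (λ _ → value-injective (strictlyInverseʳ _))

-- The pushout of sets  B ←g− A −h→ C  with h injective and of decidable image:
-- B together with the elements of C outside the image of h.
module InjectivePushout {A B C : Set} (g : A → B) (h : A → C)
  (h-injective : ∀ x y → h x ≡ h y → x ≡ y)
  (h-image? : ∀ c → Dec (∃ λ a → h a ≡ c)) where

  Fresh : C → Set
  Fresh c = ¬ ∃ λ a → h a ≡ c

  -- the freshness witness is irrelevant, so a fresh element is determined by its value
  Carrier : Set
  Carrier = B ⊎ [ c ∈ C ∣ Fresh c ]

  not-image : ∀ {c} → Irrelevant (Fresh c) → ∀ a → h a ≡ c → ⊥
  not-image [ fresh ] a p = ⊥-elim-irr (fresh (a , p))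

  ι₂ : C → Carrier
  ι₂ c with h-image? c
  ... | yes (a , _) = inj₁ (g a)
  ... | no fresh    = inj₂ (c , [ fresh ])

  ι₂-h : ∀ a → ι₂ (h a) ≡ inj₁ (g a)
  ι₂-h a with h-image? (h a)
  ... | yes (a′ , ha′≡ha) = cong (inj₁ ∘ g) (h-injective a′ a ha′≡ha)
  ... | no fresh          = ⊥-elim (fresh (a , refl))

  ι₂-fresh : (c : [ c ∈ C ∣ Fresh c ]) → ι₂ (value c) ≡ inj₂ c
  ι₂-fresh (c , fresh) with h-image? c
  ... | yes (a , ha≡c) = ⊥-elim (not-image fresh a ha≡c)
  ... | no _           = refl

  -- the square is a pullback: elements identified in the pushout come from A
  glued : ∀ {b c} → inj₁ b ≡ ι₂ c → ∃ λ a → g a ≡ b × h a ≡ c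
  glued {c = c} eq with h-image? c
  glued refl | yes (a , ha≡c) = a , refl , ha≡c

  ι₂-injective : (∀ x y → g x ≡ g y → x ≡ y) → ∀ c c′ → ι₂ c ≡ ι₂ c′ → c ≡ c′
  ι₂-injective g-injective c c′ eq with h-image? c | h-image? c′
  ... | yes (a , refl) | yes (a′ , refl) = cong h (g-injective a a′ (inj₁-injective eq))
  ... | no _           | no _            = cong value (inj₂-injective eq)

  copair : {X : Set} → (B → X) → (C → X) → Carrier → X
  copair u v (inj₁ b) = u b
  copair u v (inj₂ c) = v (value c)

  copair-ι₂ : {X : Set} {u : B → X} {v : C → X} → (∀ a → u (g a) ≡ v (h a)) →
              ∀ c → copair u v (ι₂ c) ≡ v c
  copair-ι₂ comm c with h-image? c
  ... | yes (a , refl) = comm a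
  ... | no _           = refl

  copair-unique : {X : Set} {u : B → X} {v : C → X} (w : Carrier → X) →
                  (∀ b → w (inj₁ b) ≡ u b) → (∀ c → w (ι₂ c) ≡ v c) →
                  ∀ p → w p ≡ copair u v p
  copair-unique w wu wv (inj₁ b) = wu b
  copair-unique w wu wv (inj₂ c) = trans (cong w (sym (ι₂-fresh c))) (wv (value c))

  finite : Finite B → Finite C → Finite Carrier
  finite fB fC = finite-⊎ fB (finite-refinement fC (¬? ∘ h-image?))

module Transport {T : Sig} {X Y : TGraph T} (f : Hom T X Y) where

  type-preserved : (Pd : TV T → Set) → ∀ v → Pd (tyV X v) → Pd (tyV Y (fV f v))
  type-preserved Pd v = subst Pd (sym (tyV-pr f v))

  type-reflected : (Pd : TV T → Set) → ∀ v → Pd (tyV Y (fV f v)) → Pd (tyV X v)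
  type-reflected Pd v = subst Pd (tyV-pr f v)

  UV-preserved : ∀ v → UV T X v → UV T Y (fV f v)
  UV-preserved = type-preserved (λ t → isBang T t ≡ false)

  UV-reflected : ∀ v → UV T Y (fV f v) → UV T X v
  UV-reflected = type-reflected (λ t → isBang T t ≡ false)

  UE-preserved : ∀ e → UE T X e → UE T Y (fE f e)
  UE-preserved e (us , ut) = subst (UV T Y) (sym (src-pr f e)) (UV-preserved _ us)
                           , subst (UV T Y) (sym (tgt-pr f e)) (UV-preserved _ ut)

  Inc-preserved : ∀ {v e} → Inc T X v e → Inc T Y (fV f v) (fE f e)
  Inc-preserved {e = e} (inj₁ p) = inj₁ (trans (src-pr f e) (cong (fV f) p))
  Inc-preserved {e = e} (inj₂ p) = inj₂ (trans (tgt-pr f e) (cong (fV f) p))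

  Succ-preserved : ∀ {a a′} → Succ T X a a′ → Succ T Y (fV f a) (fV f a′)
  Succ-preserved (e , p , q) = fE f e , trans (src-pr f e) (cong (fV f) p)
                                      , trans (tgt-pr f e) (cong (fV f) q)

incident-type : {T : Sig} (X : TGraph T) {n : V X} {d : E X} {fm : Sig.M T} →
                Inc T X n d → IsNode T X n fm →
                (tsrc T (tyE X d) ≡ mo fm) ⊎ (ttgt T (tyE X d) ≡ mo fm)
incident-type X {d = d} (inj₁ p) isn = inj₁ (trans (src-ty X d) (trans (cong (tyV X) p) isn))
incident-type X {d = d} (inj₂ p) isn = inj₂ (trans (tgt-ty X d) (trans (cong (tyV X) p) isn))

module GraphPushout {T : Sig} {G I H : TGraph T} (g : Hom T I G) (h : Hom T I H) (mh : Mono T h)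
  (imageV? : ∀ v → Dec (∃ λ x → fV h x ≡ v)) (imageE? : ∀ e → Dec (∃ λ x → fE h x ≡ e)) where

  infixr 9 _∘ᴴ_
  _∘ᴴ_ : {X Y Z : TGraph T} → Hom T Y Z → Hom T X Y → Hom T X Z
  _∘ᴴ_ = _∘H_ T

  infix 4 _≈ᴴ_
  _≈ᴴ_ : {X Y : TGraph T} → Hom T X Y → Hom T X Y → Set
  _≈ᴴ_ = _≈H_ T

  module PV = InjectivePushout (fV g) (fV h) (proj₁ mh) imageV?
  module PE = InjectivePushout (fE g) (fE h) (proj₂ mh) imageE?

  tyV-ι₂ : ∀ v → PV.copair (tyV G) (tyV H) (PV.ι₂ v) ≡ tyV H v
  tyV-ι₂ = PV.copair-ι₂ (λ x → trans (tyV-pr g x) (sym (tyV-pr h x)))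

  tyE-ι₂ : ∀ e → PE.copair (tyE G) (tyE H) (PE.ι₂ e) ≡ tyE H e
  tyE-ι₂ = PE.copair-ι₂ (λ x → trans (tyE-pr g x) (sym (tyE-pr h x)))

  P : TGraph T
  P = record
    { V = PV.Carrier
    ; E = PE.Carrier
    ; src = PE.copair (inj₁ ∘ src G) (PV.ι₂ ∘ src H)
    ; tgt = PE.copair (inj₁ ∘ tgt G) (PV.ι₂ ∘ tgt H)
    ; tyV = PV.copair (tyV G) (tyV H)
    ; tyE = PE.copair (tyE G) (tyE H)
    ; src-ty = λ { (inj₁ e) → src-ty G e ; (inj₂ (d , _)) → trans (src-ty H d) (sym (tyV-ι₂ (src H d))) }
    ; tgt-ty = λ { (inj₁ e) → tgt-ty G e ; (inj₂ (d , _)) → trans (tgt-ty H d) (sym (tyV-ι₂ (tgt H d))) }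
    }

  src-glued : ∀ x → inj₁ (src G (fE g x)) ≡ PV.ι₂ (src H (fE h x))
  src-glued x = begin
    inj₁ (src G (fE g x))   ≡⟨ cong inj₁ (src-pr g x) ⟩
    inj₁ (fV g (src I x))   ≡⟨ sym (PV.ι₂-h (src I x)) ⟩
    PV.ι₂ (fV h (src I x))  ≡⟨ cong PV.ι₂ (sym (src-pr h x)) ⟩
    PV.ι₂ (src H (fE h x))  ∎
    where open ≡-Reasoning

  tgt-glued : ∀ x → inj₁ (tgt G (fE g x)) ≡ PV.ι₂ (tgt H (fE h x))
  tgt-glued x = begin
    inj₁ (tgt G (fE g x))   ≡⟨ cong inj₁ (tgt-pr g x) ⟩
    inj₁ (fV g (tgt I x))   ≡⟨ sym (PV.ι₂-h (tgt I x)) ⟩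
    PV.ι₂ (fV h (tgt I x))  ≡⟨ cong PV.ι₂ (sym (tgt-pr h x)) ⟩
    PV.ι₂ (tgt H (fE h x))  ∎
    where open ≡-Reasoning

  ι₁ : Hom T G P
  ι₁ = record { fV = inj₁ ; fE = inj₁ ; src-pr = λ _ → refl ; tgt-pr = λ _ → refl
              ; tyV-pr = λ _ → refl ; tyE-pr = λ _ → refl }

  ι₂ : Hom T H P
  ι₂ = record { fV = PV.ι₂ ; fE = PE.ι₂
              ; src-pr = PE.copair-ι₂ src-glued ; tgt-pr = PE.copair-ι₂ tgt-glued
              ; tyV-pr = tyV-ι₂ ; tyE-pr = tyE-ι₂ }

  commutes : (ι₁ ∘ᴴ g) ≈ᴴ (ι₂ ∘ᴴ h)
  commutes = (λ x → sym (PV.ι₂-h x)) , (λ x → sym (PE.ι₂-h x))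

  -- Any cocone (q₁, q₂) factors uniquely through (ι₁, ι₂); the target need not be a !-graph.
  universal : (Q : TGraph T) (q₁ : Hom T G Q) (q₂ : Hom T H Q) → (q₁ ∘ᴴ g) ≈ᴴ (q₂ ∘ᴴ h) →
              Σ (Hom T P Q) λ u → ((u ∘ᴴ ι₁) ≈ᴴ q₁) × ((u ∘ᴴ ι₂) ≈ᴴ q₂)
                × (∀ (u′ : Hom T P Q) → (u′ ∘ᴴ ι₁) ≈ᴴ q₁ → (u′ ∘ᴴ ι₂) ≈ᴴ q₂ → u′ ≈ᴴ u)
  universal Q q₁ q₂ (commV , commE) =
      u , ((λ _ → refl) , (λ _ → refl)) , (uV-ι₂ , uE-ι₂)
    , λ u′ (u′₁V , u′₁E) (u′₂V , u′₂E) → PV.copair-unique (fV u′) u′₁V u′₂V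
                                       , PE.copair-unique (fE u′) u′₁E u′₂E
    where
    uV-ι₂ : ∀ v → PV.copair (fV q₁) (fV q₂) (PV.ι₂ v) ≡ fV q₂ v
    uV-ι₂ = PV.copair-ι₂ commV
    uE-ι₂ : ∀ e → PE.copair (fE q₁) (fE q₂) (PE.ι₂ e) ≡ fE q₂ e
    uE-ι₂ = PE.copair-ι₂ commE
    u : Hom T P Q
    u = record
      { fV = PV.copair (fV q₁) (fV q₂)
      ; fE = PE.copair (fE q₁) (fE q₂)
      ; src-pr = λ { (inj₁ e) → src-pr q₁ e ; (inj₂ (d , _)) → trans (src-pr q₂ d) (sym (uV-ι₂ (src H d))) }
      ; tgt-pr = λ { (inj₁ e) → tgt-pr q₁ e ; (inj₂ (d , _)) → trans (tgt-pr q₂ d) (sym (uV-ι₂ (tgt H d))) }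
      ; tyV-pr = λ { (inj₁ a) → tyV-pr q₁ a ; (inj₂ (b , _)) → tyV-pr q₂ b }
      ; tyE-pr = λ { (inj₁ a) → tyE-pr q₁ a ; (inj₂ (b , _)) → tyE-pr q₂ b }
      }

  -- (P, ι₁, ι₂) is a pushout in Graph/G_{T!}, hence in every full subcategory containing P
  isPushout : IsPushout T g h ι₁ ι₂
  isPushout = commutes , λ Q _ → universal Q

module StringParts {T : Sig} (X : TGraph T) {SV : V X → Set} {SE : E X → Set}
                   (s : IsStringOn T X SV SE) where

  node-injective : ∀ n fm → SV n → IsNode T X n fm → ∀ e d → SE e → SE d →
                   Inc T X n e → Inc T X n d → IsFixed T X e → IsFixed T X d →
                   tyE X e ≡ tyE X d → e ≡ d
  node-injective n fm sn isn = proj₁ (proj₁ (proj₂ s) n fm sn isn)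

  node-complete : ∀ n fm → SV n → IsNode T X n fm → ∀ t → IsFixedT T t →
                  (tsrc T t ≡ mo fm) ⊎ (ttgt T t ≡ mo fm) →
                  Σ (E X) λ e → SE e × Inc T X n e × tyE X e ≡ t
  node-complete n fm sn isn = proj₂ (proj₁ (proj₂ s) n fm sn isn)

  in-unique : ∀ w → SV w → IsWire T X w → ∀ e d → SE e → SE d → tgt X e ≡ w → tgt X d ≡ w → e ≡ d
  in-unique = proj₁ (proj₂ (proj₂ s))

  out-unique : ∀ w → SV w → IsWire T X w → ∀ e d → SE e → SE d → src X e ≡ w → src X d ≡ w → e ≡ d
  out-unique = proj₂ (proj₂ (proj₂ s))

module BGraphParts {T : Sig} (X : TGraph T) (bg : IsBGraph T X) where

  finite-V : Finite (V X)
  finite-V = proj₁ bg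

  finite-E : Finite (E X)
  finite-E = proj₁ (proj₂ bg)

  string : UIsString T X
  string = proj₁ (proj₂ (proj₂ bg))

  open StringParts X string public

  parallel-unique : ∀ e d → IsBangV T X (src X e) → IsBangV T X (tgt X e) →
                    src X e ≡ src X d → tgt X e ≡ tgt X d → e ≡ d
  parallel-unique = proj₁ (proj₁ (proj₂ (proj₂ (proj₂ bg))))

  reflexive : ∀ b → IsBangV T X b → Succ T X b b
  reflexive = proj₁ (proj₂ (proj₁ (proj₂ (proj₂ (proj₂ bg)))))

  antisymmetric : ∀ b b′ → IsBangV T X b → IsBangV T X b′ → Succ T X b b′ → Succ T X b′ b → b ≡ b′
  antisymmetric = proj₂ (proj₂ (proj₂ (proj₁ (proj₂ (proj₂ (proj₂ bg))))))

  boxes-open : ∀ b → IsBangV T X b → IsOpenIn T X (UV T X) (UE T X) (UBV T X b) (UBE T X b)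
  boxes-open = proj₁ (proj₂ (proj₂ (proj₂ (proj₂ bg))))

  boxes-nested : ∀ b b′ → IsBangV T X b → IsBangV T X b′ → Succ T X b b′ →
                 ∀ v → Succ T X b′ v → Succ T X b v
  boxes-nested = proj₂ (proj₂ (proj₂ (proj₂ (proj₂ bg))))

string-subgraph : {T : Sig} (X : TGraph T) → UIsString T X →
                  (SV : V X → Set) (SE : E X → Set) →
                  (∀ v → SV v → UV T X v) → (∀ e → SE e → UE T X e) →
                  (∀ e → SE e → SV (src X e) × SV (tgt X e)) →
                  (∀ e → UE T X e → IsFixed T X e → SV (src X e) ⊎ SV (tgt X e) → SE e) →
                  IsStringOn T X SV SE
string-subgraph {T} X string SV SE SV⊆UV SE⊆UE subgraph fixed-closed =
    subgraph
  , (λ n fm sn isn →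
        (λ e d se sd → node-injective n fm (SV⊆UV n sn) isn e d (SE⊆UE e se) (SE⊆UE d sd))
      , λ t ft dir → complete n fm sn isn t ft dir (node-complete n fm (SV⊆UV n sn) isn t ft dir))
  , (λ w sw ww e d se sd → in-unique w (SV⊆UV w sw) ww e d (SE⊆UE e se) (SE⊆UE d sd))
  , (λ w sw ww e d se sd → out-unique w (SV⊆UV w sw) ww e d (SE⊆UE e se) (SE⊆UE d sd))
  where
  open StringParts X string
  -- the edge found by completeness in U(X) is fixed and incident to the subgraph, hence in it
  complete : ∀ n fm → SV n → IsNode T X n fm → ∀ t → IsFixedT T t → (tsrc T t ≡ mo fm) ⊎ (ttgt T t ≡ mo fm) →
             Σ (E X) (λ e → UE T X e × Inc T X n e × tyE X e ≡ t) →
             Σ (E X) λ e → SE e × Inc T X n e × tyE X e ≡ t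
  complete n fm sn isn t ft dir (e , ue , inc , ty) =
    e , fixed-closed e ue (subst (IsFixedT T) (sym ty) ft)
          (Sum.map (λ p → subst SV (sym p) sn) (λ p → subst SV (sym p) sn) inc)
      , inc , ty

-- Openness of !-boxes, unpacked as closure of every box under following U-edges of a
-- given class C of typegraph edges (wire-targeted edges forwards, wire-sourced edges
-- backwards, fixed-arity edges both ways).
module BoxClosure {T : Sig} (X : TGraph T) where

  ForwardClosed : (TE T → Set) → Set
  ForwardClosed C = ∀ b → IsBangV T X b → ∀ e → UE T X e → C (tyE X e) →
                    Succ T X b (src X e) → Succ T X b (tgt X e)

  BackwardClosed : (TE T → Set) → Set
  BackwardClosed C = ∀ b → IsBangV T X b → ∀ e → UE T X e → C (tyE X e) →
                     Succ T X b (tgt X e) → Succ T X b (src X e)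

  WireTarget : TE T → Set
  WireTarget t = IsWireT T (ttgt T t)

  WireSource : TE T → Set
  WireSource t = IsWireT T (tsrc T t)

  BoxesOpen : Set
  BoxesOpen = ∀ b → IsBangV T X b → IsOpenIn T X (UV T X) (UE T X) (UBV T X b) (UBE T X b)

  module FromOpen (boxes-open : BoxesOpen) where

    forward-wire : ForwardClosed WireTarget
    forward-wire b bb e ue c s =
      proj₂ (proj₁ (proj₂ (proj₂ (proj₂ (boxes-open b bb)))) e ue (proj₁ ue , s)
                    (subst (IsWireT T) (tgt-ty X e) c))

    backward-wire : BackwardClosed WireSource
    backward-wire b bb e ue c s =
      proj₂ (proj₁ (proj₂ (proj₂ (proj₂ (proj₂ (boxes-open b bb))))) e ue (proj₂ ue , s)
                    (subst (IsWireT T) (src-ty X e) c))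

    forward-fixed : ForwardClosed (IsFixedT T)
    forward-fixed b bb e ue c s =
      proj₂ (proj₂ (proj₂ (proj₂ (proj₂ (proj₂ (proj₂ (boxes-open b bb))))) e ue c (inj₁ (proj₁ ue , s))))

    backward-fixed : BackwardClosed (IsFixedT T)
    backward-fixed b bb e ue c s =
      proj₁ (proj₂ (proj₂ (proj₂ (proj₂ (proj₂ (proj₂ (boxes-open b bb))))) e ue c (inj₂ (proj₂ ue , s))))

  closed⇒open : UIsString T X → ForwardClosed WireTarget → BackwardClosed WireSource →
                ForwardClosed (IsFixedT T) → BackwardClosed (IsFixedT T) → BoxesOpen
  closed⇒open string fwd-wire bwd-wire fwd-fixed bwd-fixed b bb =
      (λ _ → proj₁) , (λ _ → proj₁)
    , string-subgraph X string (UBV T X b) (UBE T X b) (λ _ → proj₁) (λ _ → proj₁)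
        (λ { e (ue , ss , st) → (proj₁ ue , ss) , (proj₂ ue , st) }) fixed-closed
    , (λ e ue (_ , s) w → proj₂ ue , fwd-wire b bb e ue (subst (IsWireT T) (sym (tgt-ty X e)) w) s)
    , (λ e ue (_ , s) w → proj₁ ue , bwd-wire b bb e ue (subst (IsWireT T) (sym (src-ty X e)) w) s)
    , fixed-closed
    where
    fixed-closed : ∀ e → UE T X e → IsFixed T X e → UBV T X b (src X e) ⊎ UBV T X b (tgt X e) → UBE T X b e
    fixed-closed e ue fx (inj₁ (_ , s)) = ue , s , fwd-fixed b bb e ue fx s
    fixed-closed e ue fx (inj₂ (_ , s)) = ue , bwd-fixed b bb e ue fx s , s

image? : {A C : Set} → Finite A → Finite C → (f : A → C) → ∀ c → Dec (∃ λ a → f a ≡ c)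
image? fA fC f c = finite-any? fA (λ a → finite-≟ fC (f a) c)

module PushoutOfBGraphs {T : Sig} {G I H : TGraph T}
  (bgG : IsBGraph T G) (bgI : IsBGraph T I) (bgH : IsBGraph T H)
  (g : Hom T I G) (h : Hom T I H) (mg : Mono T g) (mh : Mono T h)
  (coh : BoundaryBangCoherent T g h) where

  private
    module G′ = BGraphParts G bgG
    module I′ = BGraphParts I bgI
    module H′ = BGraphParts H bgH

  open GraphPushout g h mh (image? I′.finite-V H′.finite-V (fV h)) (image? I′.finite-E H′.finite-E (fE h)) public
  open Transport

  inputs-coherent : ∀ v → IsInput T I v → IsInput T G (fV g v) ⊎ IsInput T H (fV h v)
  inputs-coherent = proj₁ (proj₁ coh)

  outputs-coherent : ∀ v → IsOutput T I v → IsOutput T G (fV g v) ⊎ IsOutput T H (fV h v)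
  outputs-coherent = proj₂ (proj₁ coh)

  g-reflects-boxes : ReflectsBangBox T g
  g-reflects-boxes = proj₁ (proj₂ coh)

  h-reflects-boxes : ReflectsBangBox T h
  h-reflects-boxes = proj₂ (proj₂ coh)

  ι₂V-injective : ∀ c c′ → PV.ι₂ c ≡ PV.ι₂ c′ → c ≡ c′
  ι₂V-injective = PV.ι₂-injective (proj₁ mg)

  UE-fresh : ∀ d → UV T P (PV.ι₂ (src H d)) × UV T P (PV.ι₂ (tgt H d)) → UE T H d
  UE-fresh d (us , ut) = UV-reflected ι₂ (src H d) us , UV-reflected ι₂ (tgt H d) ut

  bang-fresh : ∀ v → IsBangV T P (PV.ι₂ v) → IsBangV T H v
  bang-fresh = type-reflected ι₂ (IsBangT T)

  -- A fresh edge of H leaving a !-vertex cannot end in the glued part: as h reflects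
  -- !-box containment, it would come from I.
  fresh-box-edge : ∀ d → Irrelevant (PE.Fresh d) → IsBangV T H (src H d) →
                   ∀ a → inj₁ a ≡ PV.ι₂ (tgt H d) → ⊥
  fresh-box-edge d fresh bd a eq with PV.glued eq
  ... | x , _ , hx≡tgt with h-reflects-boxes d bd x (sym hx≡tgt)
  ... | e , he≡d = PE.not-image fresh e he≡d

  box-into-G : ∀ {b a} → IsBangV T P b → Succ T P b (inj₁ a) →
               Σ (V G) λ b′ → IsBangV T G b′ × Succ T G b′ a × inj₁ b′ ≡ b
  box-into-G bb (inj₁ e , refl , te) = src G e , bb , (e , refl , inj₁-injective te) , refl
  box-into-G bb (inj₂ (d , fresh) , refl , te) =
    ⊥-elim (fresh-box-edge d fresh (bang-fresh (src H d) bb) _ (sym te))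

  -- A !-box edge of P into the part coming from H is the image of a !-box edge of H; for an
  -- edge of G this uses that g reflects !-box containment to pull it back to I.
  box-into-H : ∀ {b w} → IsBangV T P b → Succ T P b (PV.ι₂ w) →
               Σ (V H) λ b′ → IsBangV T H b′ × Succ T H b′ w × PV.ι₂ b′ ≡ b
  box-into-H bb (inj₂ (d , _) , refl , te) =
    src H d , bang-fresh (src H d) bb , (d , refl , ι₂V-injective _ _ te) , refl
  box-into-H bb (inj₁ c , refl , te) with PV.glued te
  ... | x , gx≡tgt , hx≡w with g-reflects-boxes c bb x (sym gx≡tgt)
  ... | c₀ , gc₀≡c =
      fV h (src I c₀) , bang-h
    , (fE h c₀ , src-pr h c₀ , trans (tgt-pr h c₀) (trans (cong (fV h) tgt≡x) hx≡w))
    , trans (PV.ι₂-h (src I c₀)) (cong inj₁ src≡)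
    where
    open ≡-Reasoning
    src≡ : fV g (src I c₀) ≡ src G c
    src≡ = trans (sym (src-pr g c₀)) (cong (src G) gc₀≡c)
    tgt≡x : tgt I c₀ ≡ x
    tgt≡x = proj₁ mg _ _ (begin
      fV g (tgt I c₀)  ≡⟨ sym (tgt-pr g c₀) ⟩
      tgt G (fE g c₀)  ≡⟨ cong (tgt G) gc₀≡c ⟩
      tgt G c          ≡⟨ sym gx≡tgt ⟩
      fV g x           ∎)
    bang-h : IsBangV T H (fV h (src I c₀))
    bang-h = type-preserved h (IsBangT T) _
               (type-reflected g (IsBangT T) _ (subst (IsBangV T G) (sym src≡) bb))

  -- β(P) is posetal.

  -- no parallel edges between !-vertices: a mixed pair would be a fresh box edge into the glued part
  parallel-unique : ∀ e d → IsBangV T P (src P e) → IsBangV T P (tgt P e) →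
                    src P e ≡ src P d → tgt P e ≡ tgt P d → e ≡ d
  parallel-unique (inj₁ e) (inj₁ d) bs bt ss st =
    cong inj₁ (G′.parallel-unique e d bs bt (inj₁-injective ss) (inj₁-injective st))
  parallel-unique (inj₂ (e , _)) (inj₂ (d , _)) bs bt ss st =
    cong inj₂ (value-injective (H′.parallel-unique e d (bang-fresh _ bs) (bang-fresh _ bt)
                                 (ι₂V-injective _ _ ss) (ι₂V-injective _ _ st)))
  parallel-unique (inj₁ e) (inj₂ (d , fresh)) bs bt ss st =
    ⊥-elim (fresh-box-edge d fresh (bang-fresh _ (subst (IsBangV T P) ss bs)) (tgt G e) st)
  parallel-unique (inj₂ (e , fresh)) (inj₁ d) bs bt ss st =
    ⊥-elim (fresh-box-edge e fresh (bang-fresh _ bs) (tgt G d) (sym st))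

  reflexive : ∀ b → IsBangV T P b → Succ T P b b
  reflexive (inj₁ a) bb = Succ-preserved ι₁ (G′.reflexive a bb)
  reflexive (inj₂ (w , fresh)) bb =
    subst (λ z → Succ T P z z) (PV.ι₂-fresh (w , fresh)) (Succ-preserved ι₂ (H′.reflexive w bb))

  -- the box of a !-vertex contains the boxes of its members (this is also transitivity of β(P))
  boxes-nested : ∀ b b′ → IsBangV T P b → IsBangV T P b′ → Succ T P b b′ → ∀ v → Succ T P b′ v → Succ T P b v
  boxes-nested b _ bb bb′ s _ (inj₁ e , refl , refl) with box-into-G bb s
  ... | c , bc , sc , refl = Succ-preserved ι₁ (G′.boxes-nested c (src G e) bc bb′ sc (tgt G e) (e , refl , refl))
  boxes-nested b _ bb bb′ s _ (inj₂ (d , _) , refl , refl) with box-into-H bb s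
  ... | c , bc , sc , refl =
    Succ-preserved ι₂ (H′.boxes-nested c (src H d) bc (bang-fresh _ bb′) sc (tgt H d) (d , refl , refl))

  transitive : ∀ b b′ b″ → IsBangV T P b → IsBangV T P b′ → IsBangV T P b″ →
               Succ T P b b′ → Succ T P b′ b″ → Succ T P b b″
  transitive b b′ b″ bb bb′ _ s s′ = boxes-nested b b′ bb bb′ s b″ s′

  antisymmetric : ∀ b b′ → IsBangV T P b → IsBangV T P b′ → Succ T P b b′ → Succ T P b′ b → b ≡ b′
  antisymmetric b _ bb bb′ s@(inj₁ e , _ , refl) s′ with box-into-G bb s
  ... | c , bc , sc , refl with box-into-G bb′ s′
  ... | _ , _ , sc′ , refl = cong inj₁ (G′.antisymmetric c (tgt G e) bc bb′ sc sc′)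
  antisymmetric b _ bb bb′ s@(inj₂ (d , _) , _ , refl) s′ with box-into-H bb s
  ... | c , bc , sc , refl with box-into-H bb′ s′
  ... | _ , _ , sc′ , ι₂c′≡ι₂tgt =
    cong PV.ι₂ (H′.antisymmetric c (tgt H d) bc (bang-fresh _ bb′) sc
                  (subst (λ z → Succ T H z c) (ι₂V-injective _ _ ι₂c′≡ι₂tgt) sc′))

  -- U(P) is a string graph.

  incident-G : ∀ {n} e → Inc T P n (inj₁ e) → Σ (V G) λ a → n ≡ inj₁ a × Inc T G a e
  incident-G e (inj₁ refl) = src G e , refl , inj₁ refl
  incident-G e (inj₂ refl) = tgt G e , refl , inj₂ refl

  incident-H : ∀ {n} (d : [ d ∈ E H ∣ PE.Fresh d ]) → Inc T P n (inj₂ d) →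
               Σ (V H) λ c → n ≡ PV.ι₂ c × Inc T H c (value d)
  incident-H (d , _) (inj₁ refl) = src H d , refl , inj₁ refl
  incident-H (d , _) (inj₂ refl) = tgt H d , refl , inj₂ refl

  -- Every fixed-arity U-edge of H at the image of a node vertex x of I comes from I:
  -- I provides an edge of the same type at x, and typing is injective at nodes of H.
  fixed-edge-at-I-node : ∀ x fm → UV T I x → IsNode T I x fm →
                         ∀ d → UE T H d → IsFixed T H d → Inc T H (fV h x) d → ∃ λ e → fE h e ≡ d
  fixed-edge-at-I-node x fm ux nx d ud fd idH
    with I′.node-complete x fm ux nx (tyE H d) fd (incident-type H idH (type-preserved h (_≡ mo fm) x nx))
  ... | e , ue , ie , ty =
    e , H′.node-injective (fV h x) fm (UV-preserved h x ux) (type-preserved h (_≡ mo fm) x nx)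
          (fE h e) d (UE-preserved h e ue) ud (Inc-preserved h ie) idH
          (subst (IsFixedT T) (sym he-type) fd) fd he-type
    where
    he-type : tyE H (fE h e) ≡ tyE H d
    he-type = trans (tyE-pr h e) ty

  no-fresh-fixed-at-G-node : ∀ n fm → UV T P n → IsNode T P n fm → ∀ e d fresh →
                             Inc T P n (inj₁ e) → Inc T P n (inj₂ (d , fresh)) →
                             UE T H d → IsFixed T H d → ⊥
  no-fresh-fixed-at-G-node n fm un isn e d fresh ie id ud fd with incident-G e ie | incident-H (d , fresh) id
  ... | a , refl , _ | c , a≡c , idH with PV.glued a≡c
  ... | x , refl , refl with fixed-edge-at-I-node x fm (UV-reflected g x un)
                               (type-reflected g (_≡ mo fm) x isn) d ud fd idH
  ... | e′ , he′≡d = PE.not-image fresh e′ he′≡d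

  node-injective : ∀ n fm → UV T P n → IsNode T P n fm → ∀ e d → UE T P e → UE T P d →
                   Inc T P n e → Inc T P n d → IsFixed T P e → IsFixed T P d →
                   tyE P e ≡ tyE P d → e ≡ d
  node-injective n fm un isn (inj₁ e) (inj₁ d) ue ud ie id fe fd ty with incident-G e ie
  ... | a , refl , ieG =
    cong inj₁ (G′.node-injective a fm un isn e d ue ud ieG
                 (Sum.map inj₁-injective inj₁-injective id) fe fd ty)
  node-injective n fm un isn (inj₂ (e , fresh)) (inj₂ (d , _)) ue ud ie id fe fd ty with incident-H (e , fresh) ie
  ... | c , refl , ieH =
    cong inj₂ (value-injective (H′.node-injective c fm (UV-reflected ι₂ c un)
                 (type-reflected ι₂ (_≡ mo fm) c isn) e d (UE-fresh e ue) (UE-fresh d ud) ieH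
                 (Sum.map (ι₂V-injective _ _) (ι₂V-injective _ _) id) fe fd ty))
  node-injective n fm un isn (inj₁ e) (inj₂ (d , fresh)) ue ud ie id fe fd ty =
    ⊥-elim (no-fresh-fixed-at-G-node n fm un isn e d fresh ie id (UE-fresh d ud) fd)
  node-injective n fm un isn (inj₂ (e , fresh)) (inj₁ d) ue ud ie id fe fd ty =
    ⊥-elim (no-fresh-fixed-at-G-node n fm un isn d e fresh id ie (UE-fresh e ue) fe)

  node-complete : ∀ n fm → UV T P n → IsNode T P n fm → ∀ t → IsFixedT T t →
                  (tsrc T t ≡ mo fm) ⊎ (ttgt T t ≡ mo fm) →
                  Σ (E P) λ e → UE T P e × Inc T P n e × tyE P e ≡ t
  node-complete (inj₁ a) fm un isn t ft dir with G′.node-complete a fm un isn t ft dir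
  ... | e , ue , ie , ty = inj₁ e , ue , Inc-preserved ι₁ ie , ty
  node-complete (inj₂ (c , fresh)) fm un isn t ft dir with H′.node-complete c fm un isn t ft dir
  ... | e , ue , ie , ty =
      PE.ι₂ e , UE-preserved ι₂ e ue
    , subst (λ z → Inc T P z (PE.ι₂ e)) (PV.ι₂-fresh (c , fresh)) (Inc-preserved ι₂ ie)
    , trans (tyE-pr ι₂ e) ty

  -- A glued wire vertex of P never receives an edge from G together with a fresh edge from H.
  -- Its preimage x in I has no incoming U-edge (its image in H would be a second incoming
  -- edge at a wire of H), so x is an input of I; boundary coherence then makes g x an input
  -- of G or h x an input of H, contradicting one of the two edges.
  no-mixed-inputs : ∀ e d → Irrelevant (PE.Fresh d) → UE T G e → UE T H d → IsWire T G (tgt G e) →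
                    inj₁ (tgt G e) ≡ PV.ι₂ (tgt H d) → ⊥
  no-mixed-inputs e d fresh ue ud we eq with PV.glued eq
  ... | x , gx≡ , hx≡ =
    either (λ (_ , _ , no-in) → no-in e ue (sym gx≡)) (λ (_ , _ , no-in) → no-in d ud (sym hx≡))
      (inputs-coherent x (ux , wx , λ e′ ue′ te′ → PE.not-image fresh e′ (second-in e′ ue′ te′)))
    where
    ux : UV T I x
    ux = UV-reflected g x (subst (UV T G) (sym gx≡) (proj₂ ue))
    wx : IsWire T I x
    wx = type-reflected g (IsWireT T) x (subst (IsWire T G) (sym gx≡) we)
    second-in : ∀ e′ → UE T I e′ → tgt I e′ ≡ x → fE h e′ ≡ d
    second-in e′ ue′ te′ =
      H′.in-unique (tgt H d) (proj₂ ud) (subst (IsWire T H) hx≡ (type-preserved h (IsWireT T) x wx))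
        (fE h e′) d (UE-preserved h e′ ue′) ud (trans (tgt-pr h e′) (trans (cong (fV h) te′) hx≡)) refl

  no-mixed-outputs : ∀ e d → Irrelevant (PE.Fresh d) → UE T G e → UE T H d → IsWire T G (src G e) →
                     inj₁ (src G e) ≡ PV.ι₂ (src H d) → ⊥
  no-mixed-outputs e d fresh ue ud we eq with PV.glued eq
  ... | x , gx≡ , hx≡ =
    either (λ (_ , _ , no-out) → no-out e ue (sym gx≡)) (λ (_ , _ , no-out) → no-out d ud (sym hx≡))
      (outputs-coherent x (ux , wx , λ e′ ue′ se′ → PE.not-image fresh e′ (second-out e′ ue′ se′)))
    where
    ux : UV T I x
    ux = UV-reflected g x (subst (UV T G) (sym gx≡) (proj₁ ue))
    wx : IsWire T I x
    wx = type-reflected g (IsWireT T) x (subst (IsWire T G) (sym gx≡) we)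
    second-out : ∀ e′ → UE T I e′ → src I e′ ≡ x → fE h e′ ≡ d
    second-out e′ ue′ se′ =
      H′.out-unique (src H d) (proj₁ ud) (subst (IsWire T H) hx≡ (type-preserved h (IsWireT T) x wx))
        (fE h e′) d (UE-preserved h e′ ue′) ud (trans (src-pr h e′) (trans (cong (fV h) se′) hx≡)) refl

  in-unique : ∀ w → UV T P w → IsWire T P w → ∀ e d → UE T P e → UE T P d →
              tgt P e ≡ w → tgt P d ≡ w → e ≡ d
  in-unique _ uw ww (inj₁ e) (inj₁ d) ue ud refl td =
    cong inj₁ (G′.in-unique (tgt G e) uw ww e d ue ud refl (inj₁-injective td))
  in-unique _ uw ww (inj₂ (e , _)) (inj₂ (d , _)) ue ud refl td =
    cong inj₂ (value-injective (H′.in-unique (tgt H e) (UV-reflected ι₂ _ uw)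
                 (type-reflected ι₂ (IsWireT T) _ ww) e d (UE-fresh e ue) (UE-fresh d ud) refl
                 (ι₂V-injective _ _ td)))
  in-unique _ uw ww (inj₁ e) (inj₂ (d , fresh)) ue ud refl td =
    ⊥-elim (no-mixed-inputs e d fresh ue (UE-fresh d ud) ww (sym td))
  in-unique _ uw ww (inj₂ (e , fresh)) (inj₁ d) ue ud te refl =
    ⊥-elim (no-mixed-inputs d e fresh ud (UE-fresh e ue) ww (sym te))

  out-unique : ∀ w → UV T P w → IsWire T P w → ∀ e d → UE T P e → UE T P d →
               src P e ≡ w → src P d ≡ w → e ≡ d
  out-unique _ uw ww (inj₁ e) (inj₁ d) ue ud refl sd =
    cong inj₁ (G′.out-unique (src G e) uw ww e d ue ud refl (inj₁-injective sd))
  out-unique _ uw ww (inj₂ (e , _)) (inj₂ (d , _)) ue ud refl sd =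
    cong inj₂ (value-injective (H′.out-unique (src H e) (UV-reflected ι₂ _ uw)
                 (type-reflected ι₂ (IsWireT T) _ ww) e d (UE-fresh e ue) (UE-fresh d ud) refl
                 (ι₂V-injective _ _ sd)))
  out-unique _ uw ww (inj₁ e) (inj₂ (d , fresh)) ue ud refl sd =
    ⊥-elim (no-mixed-outputs e d fresh ue (UE-fresh d ud) ww (sym sd))
  out-unique _ uw ww (inj₂ (e , fresh)) (inj₁ d) ue ud se refl =
    ⊥-elim (no-mixed-outputs d e fresh ud (UE-fresh e ue) ww (sym se))

  string : UIsString T P
  string = (λ _ ue → ue) , (λ n fm un isn → node-injective n fm un isn , node-complete n fm un isn)
         , in-unique , out-unique

  -- The !-boxes of P are open: each closure property is inherited from G and H.

  open BoxClosure using (ForwardClosed; BackwardClosed; WireTarget; WireSource)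

  forward-closed : ∀ C → ForwardClosed G C → ForwardClosed H C → ForwardClosed P C
  forward-closed C clG clH b bb (inj₁ e) ue c s with box-into-G bb s
  ... | b′ , bb′ , s′ , refl = Succ-preserved ι₁ (clG b′ bb′ e ue c s′)
  forward-closed C clG clH b bb (inj₂ (d , _)) ue c s with box-into-H bb s
  ... | b′ , bb′ , s′ , refl = Succ-preserved ι₂ (clH b′ bb′ d (UE-fresh d ue) c s′)

  backward-closed : ∀ C → BackwardClosed G C → BackwardClosed H C → BackwardClosed P C
  backward-closed C clG clH b bb (inj₁ e) ue c s with box-into-G bb s
  ... | b′ , bb′ , s′ , refl = Succ-preserved ι₁ (clG b′ bb′ e ue c s′)
  backward-closed C clG clH b bb (inj₂ (d , _)) ue c s with box-into-H bb s
  ... | b′ , bb′ , s′ , refl = Succ-preserved ι₂ (clH b′ bb′ d (UE-fresh d ue) c s′)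

  boxes-open : BoxClosure.BoxesOpen P
  boxes-open = BoxClosure.closed⇒open P string
    (forward-closed (WireTarget G) G-closure.forward-wire H-closure.forward-wire)
    (backward-closed (WireSource G) G-closure.backward-wire H-closure.backward-wire)
    (forward-closed (IsFixedT T) G-closure.forward-fixed H-closure.forward-fixed)
    (backward-closed (IsFixedT T) G-closure.backward-fixed H-closure.backward-fixed)
    where
    module G-closure = BoxClosure.FromOpen G G′.boxes-open
    module H-closure = BoxClosure.FromOpen H H′.boxes-open

  isBGraph : IsBGraph T P
  isBGraph = PV.finite G′.finite-V H′.finite-V , PE.finite G′.finite-E H′.finite-E , string
           , (parallel-unique , reflexive , transitive , antisymmetric) , boxes-open , boxes-nested

proposition4p14 : (T : Sig) (G I H : TGraph T) →
    IsBGraph T G → IsBGraph T I → IsBGraph T H →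
    (g : Hom T I G) (h : Hom T I H) → Mono T g → Mono T h →
    BoundaryBangCoherent T g h → HasPushoutInBGraph T g h
proposition4p14 T G I H bgG bgI bgH g h mg mh coh = P , isBGraph , ι₁ , ι₂ , isPushout
  where open PushoutOfBGraphs bgG bgI bgH g h mg mh coh
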